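{- Let $G\neq1$ be a finite abelian group and $a,b\in G$ with $o(a)\neq o(b)$ and $o(a),o(b)\ge3$; put $R=\{a,a^{ -1}\}$, $L=\{b,b^{ -1}\}$, suppose $R\cap L=\emptyset$ and $\Gamma=\mathrm{SC}(G;R,L,\{1\})$ is connected. Then $\Gamma$ is normal if and only if $\Gamma$ is intransitive.
   Context: $\mathrm{SC}(G;R,L,\{1\})$ is the graph with vertex set $G\times\{1,2\}$ and edges $\{(x,1),(y,1)\}$ for $yx^{ -1}\in R$, $\{(x,2),(y,2)\}$ for $yx^{ -1}\in L$, and $\{(x,1),(x,2)\}$ for $x\in G$. $R_G=\{\rho_g\mid g\in G\}$ where $(x,i)^{\rho_g}=(xg,i)$; $\Gamma$ is normal if $R_G\trianglelefteq\mathrm{Aut}(\Gamma)$. Intransitive means $\mathrm{Aut}(\Gamma)$ is not transitive on vertices. -}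

module Defs where

open import Level using (0ℓ)
open import Data.Nat using (ℕ; zero; suc; _<_)
open import Data.Fin using (Fin)
open import Data.Product using (Σ; ∃; _×_; _,_)
open import Data.Sum using (_⊎_)
open import Relation.Nullary using (¬_)
open import Relation.Binary.PropositionalEquality using (_≡_; _≢_)
open import Relation.Binary.Construct.Closure.ReflexiveTransitive using (Star)
open import Algebra.Structures using (IsAbelianGroup)
open import Function.Bundles using (_↔_; Inverse; _⇔_)

record FiniteAbelianGroup : Set₁ where
  infixl 7 _∙_
  infix 8 _⁻¹
  field
    Carrier        : Set
    _∙_            : Carrier → Carrier → Carrier
    ε              : Carrier
    _⁻¹            : Carrier → Carrier
    isAbelianGroup : IsAbelianGroup _≡_ _∙_ ε _⁻¹
    finite         : Σ ℕ λ n → Fin n ↔ Carrier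

module _ (G : FiniteAbelianGroup) where
  open FiniteAbelianGroup G

  pow : Carrier → ℕ → Carrier
  pow x zero    = ε
  pow x (suc n) = pow x n ∙ x

  IsOrder : Carrier → ℕ → Set
  IsOrder x n = (0 < n) × (pow x n ≡ ε) × (∀ m → 0 < m → m < n → pow x m ≢ ε)

  Nontrivial : Set
  Nontrivial = ∃ λ x → x ≢ ε

  InPair : Carrier → Carrier → Set
  InPair c x = (x ≡ c) ⊎ (x ≡ c ⁻¹)

  -- vertex set G × {1,2}; Fin 2 index 0 stands for 1, index 1 for 2
  Vertex : Set
  Vertex = Carrier × Fin 2

  Adj : Carrier → Carrier → Vertex → Vertex → Set
  Adj a b (x , Fin.zero)          (y , Fin.zero)          = InPair a (y ∙ x ⁻¹)
  Adj a b (x , Fin.suc Fin.zero)  (y , Fin.suc Fin.zero)  = InPair b (y ∙ x ⁻¹)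
  Adj a b (x , Fin.zero)          (y , Fin.suc Fin.zero)  = x ≡ y
  Adj a b (x , Fin.suc Fin.zero)  (y , Fin.zero)          = x ≡ y

  Connected : Carrier → Carrier → Set
  Connected a b = ∀ u v → Star (Adj a b) u v

  record Automorphism (a b : Carrier) : Set where
    field
      perm     : Vertex ↔ Vertex
      preserve : ∀ u v → Adj a b u v ⇔ Adj a b (Inverse.to perm u) (Inverse.to perm v)

  ρ : Carrier → Vertex → Vertex
  ρ g (x , i) = (x ∙ g , i)

  -- R_G is normal in Aut(Γ): every conjugate σ⁻¹ ρ_g σ lies in R_G
  IsNormal : Carrier → Carrier → Set
  IsNormal a b = ∀ (σ : Automorphism a b) (g : Carrier) → ∃ λ h → ∀ v →
    Inverse.from (Automorphism.perm σ) (ρ g (Inverse.to (Automorphism.perm σ) v)) ≡ ρ h v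

  VertexTransitive : Carrier → Carrier → Set
  VertexTransitive a b = ∀ u v → ∃ λ (σ : Automorphism a b) → Inverse.to (Automorphism.perm σ) u ≡ v

  Intransitive : Carrier → Carrier → Set
  Intransitive a b = ¬ VertexTransitive a b

-- If some automorphism of Γ exchanges the layers G × {1} and G × {2}, then Γ is vertex-transitive;
-- if moreover R_G is normal, conjugation by that automorphism induces an automorphism of G sending a
-- into {b, b⁻¹}, contradicting o(a) ≠ o(b).
-- Conversely, if Γ is intransitive, every automorphism fixes both layers and acts on each by the
-- same permutation f of G, so Δ_c(x) = f(xc) f(x)⁻¹ lies in {c, c⁻¹} for c ∈ {a, b}; as c² ≠ 1,
-- Δ_c(xc) = Δ_c(x). If Δ_a(xb) ≠ Δ_a(x), the commuting square f(xab) = f(xba) makes Δ_a alternate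
-- along b-cycles and Δ_b along a-cycles, so both orders are even, and then Δ_a(x)² = Δ_b(x)² gives
-- o(a) = o(b). So Δ_a and Δ_b are invariant under a and b, hence constant by connectivity, and f
-- conjugates every right translation of G to a translation: R_G is normal.
module Submission where

open import Level using (0ℓ)
open import Data.Nat using (ℕ; zero; suc; _+_; _≤_; z≤n; s≤s)
open import Data.Nat.Properties using (+-suc; <-cmp; +-mono-<)
open import Data.Fin.Patterns using (0F; 1F)
open import Data.Product using (_×_; _,_; proj₁; proj₂; ∃)
open import Data.Sum using (_⊎_; inj₁; inj₂)
open import Data.Empty using (⊥; ⊥-elim)
open import Function.Base using (id; _∘_)
open import Function.Bundles using (_⇔_; Inverse; Equivalence; Injection; mk⇔; mk↔ₛ′)
open import Function.Construct.Composition using (_↔-∘_; _⇔-∘_)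
open import Function.Construct.Identity using (⇔-id)
open import Function.Construct.Symmetry using (↔-sym; ⇔-sym)
open import Function.Properties.Inverse using (↔⇒↣)
open import Relation.Nullary using (¬_)
open import Relation.Binary.Definitions using (tri<; tri≈; tri>)
open import Relation.Binary.PropositionalEquality
open import Relation.Binary.Construct.Closure.ReflexiveTransitive using (Star; _◅_) renaming (ε to done)
open import Algebra.Bundles using (AbelianGroup; Group)
import Algebra.Properties.AbelianGroup as AbelianGroupProperties
import Algebra.Properties.CommutativeSemigroup as CommutativeSemigroupProperties
open import Defs

EvenOrOdd : ℕ → Set
EvenOrOdd n = (∃ λ l → n ≡ l + l) ⊎ (∃ λ l → n ≡ suc (l + l))

even⊎odd : ∀ n → EvenOrOdd n
even⊎odd zero = inj₁ (0 , refl)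
even⊎odd (suc n) with even⊎odd n
... | inj₁ (l , n≡l+l) = inj₂ (l , cong suc n≡l+l)
... | inj₂ (l , n≡1+l+l) = inj₁ (suc l , cong suc (trans n≡1+l+l (sym (+-suc l l))))

module _ (G : FiniteAbelianGroup) where
  open FiniteAbelianGroup G

  abelianGroup : AbelianGroup 0ℓ 0ℓ
  abelianGroup = record { isAbelianGroup = isAbelianGroup }

  open AbelianGroup abelianGroup using (assoc; comm; identityˡ; identityʳ; inverseˡ; inverseʳ; group)
  open Group group using (_//_; _\\_)
  open AbelianGroupProperties abelianGroup
    using (∙-cancelʳ; ⁻¹-injective; ⁻¹-involutive; ε⁻¹≈ε; ⁻¹-∙-comm; inverseʳ-unique; identityˡ-unique;
           identityʳ-unique; y≈x\\z; \\-leftDividesˡ; //-rightDividesˡ; //-rightDividesʳ)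
  open CommutativeSemigroupProperties (AbelianGroup.commutativeSemigroup abelianGroup)
    using (interchange; x∙yz≈y∙xz; xy∙z≈xz∙y)
  open ≡-Reasoning

  x//ε≡x : ∀ x → x // ε ≡ x
  x//ε≡x x = trans (cong (x ∙_) ε⁻¹≈ε) (identityʳ x)

  x∙[y//x]≡y : ∀ x y → x ∙ (y // x) ≡ y
  x∙[y//x]≡y x y = trans (comm x (y // x)) (//-rightDividesˡ x y)

  [x∙c]//x≡c : ∀ x c → (x ∙ c) // x ≡ c
  [x∙c]//x≡c x c = trans (cong (_// x) (comm x c)) (//-rightDividesʳ x c)

  [y∙g]//[x∙g]≡y//x : ∀ x y g → (y ∙ g) // (x ∙ g) ≡ y // x
  [y∙g]//[x∙g]≡y//x x y g = begin
    (y ∙ g) ∙ (x ∙ g) ⁻¹      ≡⟨ cong ((y ∙ g) ∙_) (sym (⁻¹-∙-comm x g)) ⟩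
    (y ∙ g) ∙ (x ⁻¹ ∙ g ⁻¹)   ≡⟨ interchange y g (x ⁻¹) (g ⁻¹) ⟩
    (y // x) ∙ (g ∙ g ⁻¹)     ≡⟨ cong ((y // x) ∙_) (inverseʳ g) ⟩
    (y // x) ∙ ε              ≡⟨ identityʳ _ ⟩
    y // x                    ∎

  squares-≡ : ∀ α β → β \\ α ≡ α \\ β → α ∙ α ≡ β ∙ β
  squares-≡ α β e = begin
    α ∙ α                ≡⟨ cong (α ∙_) (sym (\\-leftDividesˡ β α)) ⟩
    α ∙ (β ∙ (β \\ α))   ≡⟨ cong (λ z → α ∙ (β ∙ z)) e ⟩
    α ∙ (β ∙ (α \\ β))   ≡⟨ x∙yz≈y∙xz α β _ ⟩
    β ∙ (α ∙ (α \\ β))   ≡⟨ cong (β ∙_) (\\-leftDividesˡ α β) ⟩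
    β ∙ β                ∎

  invariant-InPair : ∀ {A : Set} (h : Carrier → A) {c s} →
    (∀ x → h (x ∙ c) ≡ h x) → InPair G c s → ∀ x → h (x ∙ s) ≡ h x
  invariant-InPair h hc (inj₁ refl) x = hc x
  invariant-InPair h {c} hc (inj₂ refl) x = trans (sym (hc (x // c))) (cong h (//-rightDividesˡ c x))

  pow-⁻¹ : ∀ x n → pow G (x ⁻¹) n ≡ pow G x n ⁻¹
  pow-⁻¹ x zero    = sym ε⁻¹≈ε
  pow-⁻¹ x (suc n) = trans (cong (_∙ x ⁻¹) (pow-⁻¹ x n)) (⁻¹-∙-comm (pow G x n) x)

  pow-double : ∀ x m → pow G x (m + m) ≡ pow G (x ∙ x) m
  pow-double x zero    = refl
  pow-double x (suc m) = begin
    pow G x (suc m + suc m)     ≡⟨ cong (pow G x ∘ suc) (+-suc m m) ⟩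
    pow G x (m + m) ∙ x ∙ x     ≡⟨ assoc _ x x ⟩
    pow G x (m + m) ∙ (x ∙ x)   ≡⟨ cong (_∙ (x ∙ x)) (pow-double x m) ⟩
    pow G (x ∙ x) (suc m)       ∎

  module _ {φ : Carrier → Carrier} (φ-hom : ∀ x y → φ (x ∙ y) ≡ φ x ∙ φ y) where

    hom-ε : φ ε ≡ ε
    hom-ε = identityˡ-unique (φ ε) (φ ε) (trans (sym (φ-hom ε ε)) (cong φ (identityˡ ε)))

    hom-pow : ∀ x n → φ (pow G x n) ≡ pow G (φ x) n
    hom-pow x zero    = hom-ε
    hom-pow x (suc n) = trans (φ-hom (pow G x n) x) (cong (_∙ φ x) (hom-pow x n))

    injective-hom-IsOrder : (∀ {x y} → φ x ≡ φ y → x ≡ y) → ∀ {x n} → IsOrder G x n → IsOrder G (φ x) n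
    injective-hom-IsOrder φ-injective {x} {n} (0<n , xⁿ≡ε , minimal) =
      0<n , trans (sym (hom-pow x n)) (trans (cong φ xⁿ≡ε) hom-ε) ,
      λ m 0<m m<n φxᵐ≡ε → minimal m 0<m m<n (φ-injective (trans (hom-pow x m) (trans φxᵐ≡ε (sym hom-ε))))

  IsOrder-unique : ∀ {x m n} → IsOrder G x m → IsOrder G x n → m ≡ n
  IsOrder-unique {m = m} {n} (0<m , xᵐ≡ε , m-minimal) (0<n , xⁿ≡ε , n-minimal) with <-cmp m n
  ... | tri< m<n _ _ = ⊥-elim (n-minimal m 0<m m<n xᵐ≡ε)
  ... | tri≈ _ m≡n _ = m≡n
  ... | tri> _ _ n<m = ⊥-elim (m-minimal n 0<n n<m xⁿ≡ε)

  IsOrder-⁻¹ : ∀ {x n} → IsOrder G x n → IsOrder G (x ⁻¹) n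
  IsOrder-⁻¹ {x} {n} (0<n , xⁿ≡ε , minimal) =
    0<n , trans (pow-⁻¹ x n) (trans (cong _⁻¹ xⁿ≡ε) ε⁻¹≈ε) ,
    λ m 0<m m<n x⁻ᵐ≡ε →
      minimal m 0<m m<n (⁻¹-injective (trans (sym (pow-⁻¹ x m)) (trans x⁻ᵐ≡ε (sym ε⁻¹≈ε))))

  InPair-IsOrder : ∀ {c x n} → InPair G c x → IsOrder G c n → IsOrder G x n
  InPair-IsOrder (inj₁ refl) o = o
  InPair-IsOrder (inj₂ refl) o = IsOrder-⁻¹ o

  IsOrder⇒≢⁻¹ : ∀ {x n} → IsOrder G x n → 3 ≤ n → x ≢ x ⁻¹
  IsOrder⇒≢⁻¹ {x} (_ , _ , minimal) 3≤n x≡x⁻¹ = minimal 2 (s≤s z≤n) 3≤n (begin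
    ε ∙ x ∙ x   ≡⟨ cong (_∙ x) (identityˡ x) ⟩
    x ∙ x       ≡⟨ cong (x ∙_) x≡x⁻¹ ⟩
    x ∙ x ⁻¹    ≡⟨ inverseʳ x ⟩
    ε           ∎)

  ≡-squares⇒≡-double-pow : ∀ {x y} → x ∙ x ≡ y ∙ y → ∀ m → pow G x (m + m) ≡ pow G y (m + m)
  ≡-squares⇒≡-double-pow {x} {y} x²≡y² m =
    trans (pow-double x m) (trans (cong (λ z → pow G z m) x²≡y²) (sym (pow-double y m)))

  ≡-squares⇒≡-half-orders : ∀ {x y k l} → IsOrder G x (k + k) → IsOrder G y (l + l) →
    x ∙ x ≡ y ∙ y → k ≡ l
  ≡-squares⇒≡-half-orders {k = k} {l} (0<2k , x²ᵏ≡ε , x-minimal) (0<2l , y²ˡ≡ε , y-minimal) x²≡y²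
    with <-cmp k l
  ... | tri< k<l _ _ = ⊥-elim (y-minimal (k + k) 0<2k (+-mono-< k<l k<l)
                                (trans (sym (≡-squares⇒≡-double-pow x²≡y² k)) x²ᵏ≡ε))
  ... | tri≈ _ k≡l _ = k≡l
  ... | tri> _ _ l<k = ⊥-elim (x-minimal (l + l) 0<2l (+-mono-< l<k l<k)
                                (trans (≡-squares⇒≡-double-pow x²≡y² l) y²ˡ≡ε))

  InPair-≡⊎≡⁻¹ : ∀ {c p q} → InPair G c p → InPair G c q → q ≡ p ⊎ q ≡ p ⁻¹
  InPair-≡⊎≡⁻¹ (inj₁ refl) (inj₁ refl) = inj₁ refl
  InPair-≡⊎≡⁻¹ (inj₂ refl) (inj₂ refl) = inj₁ refl
  InPair-≡⊎≡⁻¹ (inj₁ refl) (inj₂ refl) = inj₂ refl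
  InPair-≡⊎≡⁻¹ (inj₂ refl) (inj₁ refl) = inj₂ (sym (⁻¹-involutive _))

  InPair-≢⁻¹ : ∀ {c p} → c ≢ c ⁻¹ → InPair G c p → p ≢ p ⁻¹
  InPair-≢⁻¹ c≢c⁻¹ (inj₁ refl) = c≢c⁻¹
  InPair-≢⁻¹ c≢c⁻¹ (inj₂ refl) = c≢c⁻¹ ∘ ⁻¹-injective

  InPair-≢⇒≡⁻¹ : ∀ {c p q} → InPair G c p → InPair G c q → q ≢ p → q ≡ p ⁻¹
  InPair-≢⇒≡⁻¹ p∈ q∈ q≢p with InPair-≡⊎≡⁻¹ p∈ q∈
  ... | inj₁ q≡p   = ⊥-elim (q≢p q≡p)
  ... | inj₂ q≡p⁻¹ = q≡p⁻¹

  module Cocycle (f : Carrier → Carrier) (f-injective : ∀ {x y} → f x ≡ f y → x ≡ y) where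

    Δ : Carrier → Carrier → Carrier
    Δ c x = f (x ∙ c) // f x

    f-∙ : ∀ c x → f (x ∙ c) ≡ Δ c x ∙ f x
    f-∙ c x = sym (//-rightDividesˡ (f x) (f (x ∙ c)))

    f-∙∙ : ∀ c d x → f (x ∙ c ∙ d) ≡ Δ d (x ∙ c) ∙ Δ c x ∙ f x
    f-∙∙ c d x = trans (f-∙ d (x ∙ c)) (trans (cong (Δ d (x ∙ c) ∙_) (f-∙ c x)) (sym (assoc _ _ _)))

    Δ-square : ∀ c d x → Δ d (x ∙ c) ∙ Δ c x ≡ Δ c (x ∙ d) ∙ Δ d x
    Δ-square c d x = ∙-cancelʳ (f x) _ _ (begin
      Δ d (x ∙ c) ∙ Δ c x ∙ f x   ≡⟨ sym (f-∙∙ c d x) ⟩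
      f (x ∙ c ∙ d)               ≡⟨ cong f (xy∙z≈xz∙y x c d) ⟩
      f (x ∙ d ∙ c)               ≡⟨ f-∙∙ d c x ⟩
      Δ c (x ∙ d) ∙ Δ d x ∙ f x   ∎)

    Δ-commutes : ∀ c d x → Δ d (x ∙ c) ≡ Δ d x → Δ c (x ∙ d) ≡ Δ c x
    Δ-commutes c d x e = sym (∙-cancelʳ (Δ d x) _ _ (begin
      Δ c x ∙ Δ d x         ≡⟨ comm _ _ ⟩
      Δ d x ∙ Δ c x         ≡⟨ cong (_∙ Δ c x) (sym e) ⟩
      Δ d (x ∙ c) ∙ Δ c x   ≡⟨ Δ-square c d x ⟩
      Δ c (x ∙ d) ∙ Δ d x   ∎))

    Δ-periodic : ∀ {c} → c ≢ c ⁻¹ → (∀ x → InPair G c (Δ c x)) → ∀ x → Δ c (x ∙ c) ≡ Δ c x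
    Δ-periodic {c} c≢c⁻¹ Δc∈ x with InPair-≡⊎≡⁻¹ (Δc∈ x) (Δc∈ (x ∙ c))
    ... | inj₁ unchanged = unchanged
    ... | inj₂ inverted =
      ⊥-elim (c≢c⁻¹ (inverseʳ-unique c c (identityʳ-unique x (c ∙ c) (f-injective (begin
        f (x ∙ (c ∙ c))             ≡⟨ cong f (sym (assoc x c c)) ⟩
        f (x ∙ c ∙ c)               ≡⟨ f-∙∙ c c x ⟩
        Δ c (x ∙ c) ∙ Δ c x ∙ f x   ≡⟨ cong (λ z → z ∙ Δ c x ∙ f x) inverted ⟩
        Δ c x ⁻¹ ∙ Δ c x ∙ f x      ≡⟨ cong (_∙ f x) (inverseˡ _) ⟩
        ε ∙ f x                     ≡⟨ identityˡ _ ⟩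
        f x                         ∎)))))

    jump⇒≡-squares : ∀ {c d} x → Δ c (x ∙ d) ≡ Δ c x ⁻¹ → Δ d (x ∙ c) ≡ Δ d x ⁻¹ →
      Δ c x ∙ Δ c x ≡ Δ d x ∙ Δ d x
    jump⇒≡-squares {c} {d} x Δc-jumps Δd-jumps = squares-≡ (Δ c x) (Δ d x) (begin
      Δ d x ⁻¹ ∙ Δ c x      ≡⟨ cong (_∙ Δ c x) (sym Δd-jumps) ⟩
      Δ d (x ∙ c) ∙ Δ c x   ≡⟨ Δ-square c d x ⟩
      Δ c (x ∙ d) ∙ Δ d x   ≡⟨ cong (_∙ Δ d x) Δc-jumps ⟩
      Δ c x ⁻¹ ∙ Δ d x      ∎)

    module _ {c d} (c≢c⁻¹ : c ≢ c ⁻¹) (Δc∈ : ∀ x → InPair G c (Δ c x))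
             (Δd-periodic : ∀ x → Δ d (x ∙ d) ≡ Δ d x) where

      jump-propagates : ∀ x → Δ c (x ∙ d) ≢ Δ c x → Δ c (x ∙ d ∙ d) ≢ Δ c (x ∙ d)
      jump-propagates x jump e = jump (Δ-commutes c d x (begin
        Δ d (x ∙ c)       ≡⟨ sym (Δd-periodic (x ∙ c)) ⟩
        Δ d (x ∙ c ∙ d)   ≡⟨ cong (Δ d) (xy∙z≈xz∙y x c d) ⟩
        Δ d (x ∙ d ∙ c)   ≡⟨ Δ-commutes d c (x ∙ d) e ⟩
        Δ d (x ∙ d)       ≡⟨ Δd-periodic x ⟩
        Δ d x             ∎))

      -- Along the d-cycle through x, Δ c then alternates between its two values.
      jump⇒odd-power≢ε : ∀ x → Δ c (x ∙ d) ≢ Δ c x → ∀ l → pow G d (suc (l + l)) ≢ ε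
      jump⇒odd-power≢ε x jump l dᵒ≡ε = InPair-≢⁻¹ c≢c⁻¹ (Δc∈ x) (begin
        Δ c x                   ≡⟨ cong (Δ c) (trans (sym (identityʳ x)) (cong (x ∙_) (sym dᵒ≡ε))) ⟩
        Δ c (y (suc (l + l)))   ≡⟨ flips (l + l) ⟩
        Δ c (y (l + l)) ⁻¹      ≡⟨ cong _⁻¹ (returns l) ⟩
        Δ c x ⁻¹                ∎)
        where
        y : ℕ → Carrier
        y n = x ∙ pow G d n

        y-suc : ∀ n → y (suc n) ≡ y n ∙ d
        y-suc n = sym (assoc x (pow G d n) d)

        jumps : ∀ n → Δ c (y n ∙ d) ≢ Δ c (y n)
        jumps zero    = subst (λ z → Δ c (z ∙ d) ≢ Δ c z) (sym (identityʳ x)) jump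
        jumps (suc n) =
          subst (λ z → Δ c (z ∙ d) ≢ Δ c z) (sym (y-suc n)) (jump-propagates (y n) (jumps n))

        flips : ∀ n → Δ c (y (suc n)) ≡ Δ c (y n) ⁻¹
        flips n = trans (cong (Δ c) (y-suc n)) (InPair-≢⇒≡⁻¹ (Δc∈ (y n)) (Δc∈ (y n ∙ d)) (jumps n))

        returns : ∀ l → Δ c (y (l + l)) ≡ Δ c x
        returns zero    = cong (Δ c) (identityʳ x)
        returns (suc l) = begin
          Δ c (y (suc l + suc l))       ≡⟨ cong (Δ c ∘ y ∘ suc) (+-suc l l) ⟩
          Δ c (y (suc (suc (l + l))))   ≡⟨ flips (suc (l + l)) ⟩
          Δ c (y (suc (l + l))) ⁻¹      ≡⟨ cong _⁻¹ (flips (l + l)) ⟩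
          Δ c (y (l + l)) ⁻¹ ⁻¹         ≡⟨ ⁻¹-involutive _ ⟩
          Δ c (y (l + l))               ≡⟨ returns l ⟩
          Δ c x                         ∎

    Δ-invariant : ∀ {c d oc od} → IsOrder G c oc → IsOrder G d od → 3 ≤ oc → 3 ≤ od → oc ≢ od →
      (∀ x → InPair G c (Δ c x)) → (∀ x → InPair G d (Δ d x)) → ∀ x → Δ c (x ∙ d) ≡ Δ c x
    Δ-invariant {c} {d} {oc} {od} Oc Od 3≤oc 3≤od oc≢od Δc∈ Δd∈ x
      with InPair-≡⊎≡⁻¹ (Δc∈ x) (Δc∈ (x ∙ d))
    ... | inj₁ unchanged = unchanged
    ... | inj₂ inverted = ⊥-elim (impossible (even⊎odd oc) (even⊎odd od))
      where
      c≢c⁻¹ = IsOrder⇒≢⁻¹ Oc 3≤oc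
      d≢d⁻¹ = IsOrder⇒≢⁻¹ Od 3≤od

      Δc-jump : Δ c (x ∙ d) ≢ Δ c x
      Δc-jump unchanged = InPair-≢⁻¹ c≢c⁻¹ (Δc∈ x) (trans (sym unchanged) inverted)

      Δd-jump : Δ d (x ∙ c) ≢ Δ d x
      Δd-jump = Δc-jump ∘ Δ-commutes c d x

      order-power : ∀ {z n m} → IsOrder G z n → n ≡ m → pow G z m ≡ ε
      order-power (_ , zⁿ≡ε , _) refl = zⁿ≡ε

      impossible : EvenOrOdd oc → EvenOrOdd od → ⊥
      impossible _ (inj₂ (l , od≡)) =
        jump⇒odd-power≢ε c≢c⁻¹ Δc∈ (Δ-periodic d≢d⁻¹ Δd∈) x Δc-jump l (order-power Od od≡)
      impossible (inj₂ (k , oc≡)) _ =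
        jump⇒odd-power≢ε d≢d⁻¹ Δd∈ (Δ-periodic c≢c⁻¹ Δc∈) x Δd-jump k (order-power Oc oc≡)
      impossible (inj₁ (k , oc≡)) (inj₁ (l , od≡)) =
        oc≢od (trans oc≡ (trans (cong (λ m → m + m) k≡l) (sym od≡)))
        where
        k≡l : k ≡ l
        k≡l = ≡-squares⇒≡-half-orders
          (subst (IsOrder G (Δ c x)) oc≡ (InPair-IsOrder (Δc∈ x) Oc))
          (subst (IsOrder G (Δ d x)) od≡ (InPair-IsOrder (Δd∈ x) Od))
          (jump⇒≡-squares x inverted (InPair-≢⇒≡⁻¹ (Δd∈ x) (Δd∈ (x ∙ c)) Δd-jump))

    Shifts : Carrier → Set
    Shifts s = ∃ λ γ → ∀ u → f (u ∙ s) ≡ γ ∙ f u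

    Shifts-ε : Shifts ε
    Shifts-ε = ε , λ u → trans (cong f (identityʳ u)) (sym (identityˡ (f u)))

    Shifts-∙ : ∀ {z s} → Shifts z → Shifts s → Shifts (z ∙ s)
    Shifts-∙ {z} {s} (γ , fz) (δ , fs) = δ ∙ γ , λ u → begin
      f (u ∙ (z ∙ s))   ≡⟨ cong f (sym (assoc u z s)) ⟩
      f (u ∙ z ∙ s)     ≡⟨ fs (u ∙ z) ⟩
      δ ∙ f (u ∙ z)     ≡⟨ cong (δ ∙_) (fz u) ⟩
      δ ∙ (γ ∙ f u)     ≡⟨ sym (assoc δ γ (f u)) ⟩
      δ ∙ γ ∙ f u       ∎

    Shifts-InPair : ∀ {c s} → Shifts c → InPair G c s → Shifts s
    Shifts-InPair shifts (inj₁ refl) = shifts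
    Shifts-InPair {c} (γ , fc) (inj₂ refl) = γ ⁻¹ , λ u →
      y≈x\\z γ (f (u // c)) (f u) (trans (sym (fc (u // c))) (cong f (//-rightDividesˡ c u)))

    constant-Δ⇒Shifts : ∀ {c} → (∀ x → Δ c x ≡ Δ c ε) → Shifts c
    constant-Δ⇒Shifts {c} Δc-constant = Δ c ε , λ u → trans (f-∙ c u) (cong (_∙ f u) (Δc-constant u))

  module _ (a b : Carrier) where

    Aut : Set
    Aut = Automorphism G a b

    act : Aut → Vertex G → Vertex G
    act σ = Inverse.to (Automorphism.perm σ)

    act-injective : ∀ σ {u v} → act σ u ≡ act σ v → u ≡ v
    act-injective σ = Injection.injective (↔⇒↣ (Automorphism.perm σ))

    act-Adj : ∀ σ {u v u′ v′} → act σ u ≡ u′ → act σ v ≡ v′ → Adj G a b u v → Adj G a b u′ v′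
    act-Adj σ {u} {v} refl refl = Equivalence.to (Automorphism.preserve σ u v)

    ρ-Adj : ∀ g u v → Adj G a b u v ⇔ Adj G a b (ρ G g u) (ρ G g v)
    ρ-Adj g (x , 0F) (y , 0F) rewrite [y∙g]//[x∙g]≡y//x x y g = ⇔-id _
    ρ-Adj g (x , 1F) (y , 1F) rewrite [y∙g]//[x∙g]≡y//x x y g = ⇔-id _
    ρ-Adj g (x , 0F) (y , 1F) = mk⇔ (cong (_∙ g)) (∙-cancelʳ g x y)
    ρ-Adj g (x , 1F) (y , 0F) = mk⇔ (cong (_∙ g)) (∙-cancelʳ g x y)

    translation : Carrier → Aut
    translation g = record
      { perm     = mk↔ₛ′ (ρ G g) (ρ G (g ⁻¹))
                     (λ (x , i) → cong (_, i) (//-rightDividesˡ g x))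
                     (λ (x , i) → cong (_, i) (//-rightDividesʳ g x))
      ; preserve = ρ-Adj g
      }

    _∘ᴬ_ : Aut → Aut → Aut
    τ ∘ᴬ σ = record
      { perm     = Automorphism.perm τ ↔-∘ Automorphism.perm σ
      ; preserve = λ u v → Automorphism.preserve τ (act σ u) (act σ v) ⇔-∘ Automorphism.preserve σ u v
      }

    _⁻¹ᴬ : Aut → Aut
    σ ⁻¹ᴬ = record
      { perm     = ↔-sym (Automorphism.perm σ)
      ; preserve = λ u v → subst₂ (λ u′ v′ → Adj G a b u′ v′ ⇔ Adj G a b (from u) (from v))
                     (strictlyInverseˡ u) (strictlyInverseˡ v)
                     (⇔-sym (Automorphism.preserve σ (from u) (from v)))
      }
      where open Inverse (Automorphism.perm σ) using (from; strictlyInverseˡ)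

    SameOrbit : Vertex G → Vertex G → Set
    SameOrbit u v = ∃ λ σ → act σ u ≡ v

    SameOrbit-sym : ∀ {u v} → SameOrbit u v → SameOrbit v u
    SameOrbit-sym {u} (σ , refl) = σ ⁻¹ᴬ , Inverse.strictlyInverseʳ (Automorphism.perm σ) u

    SameOrbit-trans : ∀ {u v w} → SameOrbit u v → SameOrbit v w → SameOrbit u w
    SameOrbit-trans (σ , refl) (τ , refl) = τ ∘ᴬ σ , refl

    SameOrbit-layer : ∀ x y i → SameOrbit (x , i) (y , i)
    SameOrbit-layer x y i = translation (x \\ y) , cong (_, i) (\\-leftDividesˡ x y)

    crossing⇒transitive : ∀ {x y} → SameOrbit (x , 0F) (y , 1F) → VertexTransitive G a b
    crossing⇒transitive {x} {y} crossing u v = SameOrbit-trans (SameOrbit-sym (from-ε u)) (from-ε v)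
      where
      from-ε : ∀ w → SameOrbit (ε , 0F) w
      from-ε (z , 0F) = SameOrbit-layer ε z 0F
      from-ε (z , 1F) =
        SameOrbit-trans (SameOrbit-layer ε x 0F) (SameOrbit-trans crossing (SameOrbit-layer y z 1F))

    LayerPreserving : Aut → Set
    LayerPreserving σ = ∀ x i → proj₂ (act σ (x , i)) ≡ i

    intransitive⇒LayerPreserving : Intransitive G a b → ∀ σ → LayerPreserving σ
    intransitive⇒LayerPreserving intransitive σ x 0F with act σ (x , 0F) in e
    ... | (y , 0F) = refl
    ... | (y , 1F) = ⊥-elim (intransitive (crossing⇒transitive (σ , e)))
    intransitive⇒LayerPreserving intransitive σ x 1F with act σ (x , 1F) in e
    ... | (y , 1F) = refl
    ... | (y , 0F) = ⊥-elim (intransitive (crossing⇒transitive (SameOrbit-sym (σ , e))))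

    Generator : Carrier → Set
    Generator s = InPair G a s ⊎ InPair G b s

    generated-induction : Connected G a b → (Q : Carrier → Set) → Q ε →
      (∀ {z s} → Generator s → Q z → Q (z ∙ s)) → ∀ y → Q y
    generated-induction connected Q Qε Q-step y = along (connected (ε , 0F) (y , 0F)) Qε
      where
      edge : ∀ {u v} → Adj G a b u v → Q (proj₁ u) → Q (proj₁ v)
      edge {x , 0F} {z , 0F} z//x∈R = subst Q (x∙[y//x]≡y x z) ∘ Q-step (inj₁ z//x∈R)
      edge {x , 1F} {z , 1F} z//x∈L = subst Q (x∙[y//x]≡y x z) ∘ Q-step (inj₂ z//x∈L)
      edge {x , 0F} {z , 1F} refl = id
      edge {x , 1F} {z , 0F} refl = id

      along : ∀ {u v} → Star (Adj G a b) u v → Q (proj₁ u) → Q (proj₁ v)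
      along done         = id
      along (e ◅ path)   = along path ∘ edge e

    invariant⇒constant : Connected G a b → ∀ {A : Set} (h : Carrier → A) →
      (∀ x → h (x ∙ a) ≡ h x) → (∀ x → h (x ∙ b) ≡ h x) → ∀ y → h y ≡ h ε
    invariant⇒constant connected h ha hb = generated-induction connected (λ y → h y ≡ h ε) refl step
      where
      step : ∀ {z s} → Generator s → h z ≡ h ε → h (z ∙ s) ≡ h ε
      step (inj₁ s∈R) = trans (invariant-InPair h ha s∈R _)
      step (inj₂ s∈L) = trans (invariant-InPair h hb s∈L _)

    normal⇒equivariant : IsNormal G a b → ∀ σ g → ∃ λ h → ∀ v → act σ (ρ G g v) ≡ ρ G h (act σ v)
    normal⇒equivariant normal σ g with normal (σ ⁻¹ᴬ) g
    ... | h , conjugate = h , λ v →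
      trans (cong (act σ ∘ ρ G g) (sym (Inverse.strictlyInverseʳ (Automorphism.perm σ) v)))
            (conjugate (act σ v))

    normal⇒intransitive : ∀ {oa ob} → IsOrder G a oa → IsOrder G b ob → oa ≢ ob →
      IsNormal G a b → Intransitive G a b
    normal⇒intransitive Oa Ob oa≢ob normal transitive =
      oa≢ob (IsOrder-unique (injective-hom-IsOrder φ-hom φ-injective Oa) (InPair-IsOrder φa∈L Ob))
      where
      σ = proj₁ (transitive (ε , 0F) (ε , 1F))

      φ : Carrier → Carrier
      φ g = proj₁ (normal⇒equivariant normal σ g)

      φ-equivariant : ∀ g v → act σ (ρ G g v) ≡ ρ G (φ g) (act σ v)
      φ-equivariant g = proj₂ (normal⇒equivariant normal σ g)

      act-φ : ∀ x → act σ (x , 0F) ≡ (φ x , 1F)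
      act-φ x = begin
        act σ (x , 0F)                 ≡⟨ cong (λ z → act σ (z , 0F)) (sym (identityˡ x)) ⟩
        act σ (ρ G x (ε , 0F))         ≡⟨ φ-equivariant x (ε , 0F) ⟩
        ρ G (φ x) (act σ (ε , 0F))     ≡⟨ cong (ρ G (φ x)) (proj₂ (transitive (ε , 0F) (ε , 1F))) ⟩
        (ε ∙ φ x , 1F)                 ≡⟨ cong (_, 1F) (identityˡ (φ x)) ⟩
        (φ x , 1F)                     ∎

      φ-hom : ∀ x y → φ (x ∙ y) ≡ φ x ∙ φ y
      φ-hom x y = cong proj₁ (begin
        (φ (x ∙ y) , 1F)             ≡⟨ sym (act-φ (x ∙ y)) ⟩
        act σ (ρ G y (x , 0F))       ≡⟨ φ-equivariant y (x , 0F) ⟩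
        ρ G (φ y) (act σ (x , 0F))   ≡⟨ cong (ρ G (φ y)) (act-φ x) ⟩
        (φ x ∙ φ y , 1F)             ∎)

      φ-injective : ∀ {x y} → φ x ≡ φ y → x ≡ y
      φ-injective {x} {y} φx≡φy =
        cong proj₁ (act-injective σ (trans (act-φ x) (trans (cong (_, 1F) φx≡φy) (sym (act-φ y)))))

      φa∈L : InPair G b (φ a)
      φa∈L = subst (InPair G b) (trans (cong (φ a //_) (hom-ε φ-hom)) (x//ε≡x (φ a)))
        (act-Adj σ (act-φ ε) (act-φ a) (inj₁ (x//ε≡x a)))

    module LayerPreservingAut (σ : Aut) (preserves-layers : LayerPreserving σ) where

      f : Carrier → Carrier
      f x = proj₁ (act σ (x , 0F))

      act-f : ∀ x i → act σ (x , i) ≡ (f x , i)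
      act-f x 0F = cong (f x ,_) (preserves-layers x 0F)
      act-f x 1F = trans layer₁ (cong (_, 1F) (sym (act-Adj σ (act-f x 0F) layer₁ refl)))
        where
        layer₁ : act σ (x , 1F) ≡ (proj₁ (act σ (x , 1F)) , 1F)
        layer₁ = cong (proj₁ (act σ (x , 1F)) ,_) (preserves-layers x 1F)

      f-injective : ∀ {x y} → f x ≡ f y → x ≡ y
      f-injective {x} {y} fx≡fy =
        cong proj₁ (act-injective σ (trans (act-f x 0F) (trans (cong (_, 0F) fx≡fy) (sym (act-f y 0F)))))

      open Cocycle f f-injective public

      Δa∈R : ∀ x → InPair G a (Δ a x)
      Δa∈R x = act-Adj σ (act-f x 0F) (act-f (x ∙ a) 0F) (inj₁ ([x∙c]//x≡c x a))

      Δb∈L : ∀ x → InPair G b (Δ b x)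
      Δb∈L x = act-Adj σ (act-f x 1F) (act-f (x ∙ b) 1F) (inj₁ ([x∙c]//x≡c x b))

      all-Shifts : ∀ {oa ob} → IsOrder G a oa → IsOrder G b ob → 3 ≤ oa → 3 ≤ ob → oa ≢ ob →
        Connected G a b → ∀ y → Shifts y
      all-Shifts Oa Ob 3≤oa 3≤ob oa≢ob connected = generated-induction connected Shifts Shifts-ε step
        where
        Δa-constant : ∀ x → Δ a x ≡ Δ a ε
        Δa-constant = invariant⇒constant connected (Δ a)
          (Δ-periodic (IsOrder⇒≢⁻¹ Oa 3≤oa) Δa∈R) (Δ-invariant Oa Ob 3≤oa 3≤ob oa≢ob Δa∈R Δb∈L)

        Δb-constant : ∀ x → Δ b x ≡ Δ b ε
        Δb-constant = invariant⇒constant connected (Δ b)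
          (Δ-invariant Ob Oa 3≤ob 3≤oa (≢-sym oa≢ob) Δb∈L Δa∈R)
          (Δ-periodic (IsOrder⇒≢⁻¹ Ob 3≤ob) Δb∈L)

        step : ∀ {z s} → Generator s → Shifts z → Shifts (z ∙ s)
        step (inj₁ s∈R) shifts-z = Shifts-∙ shifts-z (Shifts-InPair (constant-Δ⇒Shifts Δa-constant) s∈R)
        step (inj₂ s∈L) shifts-z = Shifts-∙ shifts-z (Shifts-InPair (constant-Δ⇒Shifts Δb-constant) s∈L)

      all-Shifts⇒normalises : (∀ y → Shifts y) → ∀ g →
        ∃ λ h → ∀ v → Inverse.from (Automorphism.perm σ) (ρ G g (act σ v)) ≡ ρ G h v
      all-Shifts⇒normalises shifts g = h , normalises
        where
        open Inverse (Automorphism.perm σ) using (from; strictlyInverseˡ; strictlyInverseʳ)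

        preimage = from (f ε ∙ g , 0F)
        h = proj₁ preimage

        fh : f h ≡ f ε ∙ g
        fh = cong proj₁ (trans (sym (act-f h (proj₂ preimage))) (strictlyInverseˡ (f ε ∙ g , 0F)))

        γ = proj₁ (shifts h)

        γ≡g : γ ≡ g
        γ≡g = ∙-cancelʳ (f ε) γ g (begin
          γ ∙ f ε         ≡⟨ sym (proj₂ (shifts h) ε) ⟩
          f (ε ∙ h)       ≡⟨ cong f (identityˡ h) ⟩
          f h             ≡⟨ fh ⟩
          f ε ∙ g         ≡⟨ comm (f ε) g ⟩
          g ∙ f ε         ∎)

        f-∙h : ∀ x → f (x ∙ h) ≡ f x ∙ g
        f-∙h x = trans (proj₂ (shifts h) x) (trans (cong (_∙ f x) γ≡g) (comm g (f x)))

        normalises : ∀ v → from (ρ G g (act σ v)) ≡ ρ G h v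
        normalises (x , i) = begin
          from (ρ G g (act σ (x , i)))   ≡⟨ cong (from ∘ ρ G g) (act-f x i) ⟩
          from (f x ∙ g , i)             ≡⟨ cong (λ z → from (z , i)) (sym (f-∙h x)) ⟩
          from (f (x ∙ h) , i)           ≡⟨ cong from (sym (act-f (x ∙ h) i)) ⟩
          from (act σ (x ∙ h , i))       ≡⟨ strictlyInverseʳ (x ∙ h , i) ⟩
          (x ∙ h , i)                    ∎

    intransitive⇒normal : ∀ {oa ob} → IsOrder G a oa → IsOrder G b ob → oa ≢ ob → 3 ≤ oa → 3 ≤ ob →
      Connected G a b → Intransitive G a b → IsNormal G a b
    intransitive⇒normal Oa Ob oa≢ob 3≤oa 3≤ob connected intransitive σ =
      all-Shifts⇒normalises (all-Shifts Oa Ob 3≤oa 3≤ob oa≢ob connected)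
      where open LayerPreservingAut σ (intransitive⇒LayerPreserving intransitive σ)

corollary3p10 : (G : FiniteAbelianGroup) → Nontrivial G →
    (a b : FiniteAbelianGroup.Carrier G) → (oa ob : ℕ) →
    IsOrder G a oa → IsOrder G b ob → oa ≢ ob → 3 ≤ oa → 3 ≤ ob →
    (∀ x → ¬ (InPair G a x × InPair G b x)) →
    Connected G a b →
    IsNormal G a b ⇔ Intransitive G a b
corollary3p10 G _ a b _ _ Oa Ob oa≢ob 3≤oa 3≤ob _ connected =
  mk⇔ (normal⇒intransitive G a b Oa Ob oa≢ob)
      (intransitive⇒normal G a b Oa Ob oa≢ob 3≤oa 3≤ob connected)
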